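{- Let $r,s,v,w,x,y,z\in\mathbb{C}$ with $rv\neq0$, and let $\alpha=(\alpha_i)_{i\geq0}$, $\beta=(\beta_i)_{i\geq0}$ be complex sequences with $\alpha_0=\beta_0$. Define sequences $\rho=(\rho_i)_{i\geq0}$ and $\sigma=(\sigma_i)_{i\geq0}$ by $\rho_0=\alpha_0$, $\rho_i=\bigl(\alpha_i-\sum_{k=0}^{i-1}\binom{i}{k}r^ks^{i-k}\rho_k\bigr)/r^i$ for $i\geq1$, and $\sigma_0=\beta_0$, $\sigma_i=\bigl(\beta_i-\sum_{k=0}^{i-1}\binom{i}{k}v^kw^{i-k}\sigma_k\bigr)/v^i$ for $i\geq1$. Then \[ P_{\alpha,\beta}^{[x,y,z]}=P_{\lambda_s,\mu}^{[0,r,s]}\cdot P_{\rho,\sigma}^{\left[\frac{x-w}{v},\,\frac{y+xs+zw-sw}{rv},\,\frac{z-s}{r}\right]}\cdot\bigl(P_{\lambda_w,\mu}^{[0,v,w]}\bigr)^t, \] where each matrix is understood as its principal $n\times n$ submatrix, for any $n\geq1$.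
   Context: For complex numbers $x,y,z$ and complex sequences $\alpha=(\alpha_i)_{i\geq0}$, $\beta=(\beta_i)_{i\geq0}$ with $\alpha_0=\beta_0$, the weighted recurrence matrix $P_{\alpha,\beta}^{[x,y,z]}=[P_{i,j}]_{i,j\geq0}$ is the infinite matrix defined by $P_{i,0}=\alpha_i$, $P_{0,j}=\beta_j$ for $i,j\geq 0$, and $P_{i,j}=xP_{i,j-1}+yP_{i-1,j-1}+zP_{i-1,j}$ for $i,j\geq1$. For $z\in\mathbb{C}$, $\lambda_z=(z^i)_{i\geq0}$ (with the convention $0^0=1$), and $\mu=(1,0,0,\ldots)$; thus $P_{\lambda_s,\mu}^{[0,r,s]}$ is the lower triangular matrix with entries $\binom{i}{j}r^js^{i-j}$. $A^t$ denotes the transpose of $A$. -}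

module Defs where

open import Level using (Level; _⊔_) renaming (suc to lsuc)
open import Data.Nat using (ℕ; zero; suc; _∸_; _≡ᵇ_)
open import Data.Nat.Combinatorics using (_C_)
open import Data.Bool using (if_then_else_)
open import Relation.Nullary using (¬_)
open import Algebra.Bundles using (CommutativeRing)

-- The inverse operation is total (its
-- value at 0 is unconstrained); it is only ever applied to nonzero elements.
record Field (c ℓ : Level) : Set (lsuc (c ⊔ ℓ)) where
  field
    commutativeRing : CommutativeRing c ℓ
  open CommutativeRing commutativeRing public
  field
    _⁻¹       : Carrier → Carrier
    0≉1       : ¬ (0# ≈ 1#)
    ⁻¹-inverse : ∀ a → ¬ (a ≈ 0#) → a * (a ⁻¹) ≈ 1#

module FieldDefs {c ℓ : Level} (F : Field c ℓ) where
  open Field F public hiding (zero)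

  Seq : Set c
  Seq = ℕ → Carrier

  Mat : Set c
  Mat = ℕ → ℕ → Carrier

  -- powers, with the convention a ^ 0 = 1 (so 0 ^ 0 = 1)
  _^_ : Carrier → ℕ → Carrier
  a ^ zero  = 1#
  a ^ suc n = a * (a ^ n)

  fromℕ : ℕ → Carrier
  fromℕ zero    = 0#
  fromℕ (suc n) = 1# + fromℕ n

  Σ< : ℕ → (ℕ → Carrier) → Carrier
  Σ< zero    f = 0#
  Σ< (suc n) f = Σ< n f + f n

  λ[_] : Carrier → Seq
  λ[ a ] i = a ^ i

  μ : Seq
  μ zero    = 1#
  μ (suc _) = 0#

  P : Carrier → Carrier → Carrier → Seq → Seq → Mat
  P x y z α β i       zero    = α i
  P x y z α β zero    (suc j) = β (suc j)
  P x y z α β (suc i) (suc j) =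
    x * P x y z α β (suc i) j + y * P x y z α β i j + z * P x y z α β i (suc j)

  transpose : Mat → Mat
  transpose A i j = A j i

  -- product of the principal n×n submatrices (entries for i,j < n)
  mul : ℕ → Mat → Mat → Mat
  mul n A B i j = Σ< n (λ k → A i k * B k j)

  module Inv (a b : Carrier) (γ : Seq) where
    -- value at index i, given (a function agreeing with) ρ on indices < i
    step : ℕ → Seq → Carrier
    step zero    f = γ zero
    step (suc i) f =
      (γ (suc i) - Σ< (suc i) (λ k → fromℕ (suc i C k) * ((a ^ k) * (b ^ (suc i ∸ k))) * f k))
        * ((a ^ suc i) ⁻¹)

    -- prefix n agrees with ρ on all indices k < n
    prefix : ℕ → Seq
    prefix zero    k = 0#
    prefix (suc n) k = if k ≡ᵇ n then step n (prefix n) else prefix n k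

    ρ : Seq
    ρ i = step i (prefix i)

  invSeq : Carrier → Carrier → Seq → Seq
  invSeq a b γ = Inv.ρ a b γ

{-# OPTIONS --safe #-}
-- The lower triangular matrix L = P^{[0,a,b]}_{λ_b,μ} has entries C(i,k) a^k b^(i-k) and
-- satisfies L_{i+1,k+1} = a L_{i,k} + b L_{i,k+1}, so applying it to a sequence f obeys
-- (L f)_{i+1} = b (L f)_i + a (L (f ∘ suc))_i.  The recursion defining ρ says exactly
-- L ρ = α.  Applying this shift rule in both indices shows that L_{r,s} Q L_{v,w}^t satisfies
-- the [x,y,z]-recurrence whenever Q satisfies the recurrence with the rescaled weights, and
-- for Q = P_{ρ,σ} its first row and column are β and α.  A weighted recurrence matrix is
-- determined by its boundary, and triangularity lets the n×n truncated products agree with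
-- the full ones below n.
module Submission where

open import Defs
open import Level using (Level)
open import Data.Nat as ℕ using (ℕ; zero; suc; _<_; _≤_; _∸_; s≤s; _≡ᵇ_)
import Data.Nat.Properties as ℕₚ
open import Data.Nat.Combinatorics using (_C_; nCn≡1; nCk+nC[k+1]≡[n+1]C[k+1])
open import Data.Bool using (true; false; T)
open import Data.Sum using (inj₁; inj₂)
open import Data.Empty using (⊥-elim)
open import Relation.Nullary using (¬_)
open import Relation.Binary.PropositionalEquality as ≡ using (_≡_)

module Factorisation {c ℓ : Level} (F : Field c ℓ) where
  open FieldDefs F
  open import Relation.Binary.Reasoning.Setoid setoid
  open import Algebra.Properties.CommutativeSemigroup +-commutativeSemigroup
    using () renaming (interchange to +-interchange)
  open import Algebra.Properties.CommutativeSemigroup *-commutativeSemigroup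
    using () renaming (x∙yz≈y∙xz to x*yz≈y*xz)
  open import Algebra.Solver.Ring.NaturalCoefficients.Default commutativeSemiring
  open import Algebra.Properties.Group +-group using (//-rightDividesˡ)

  Σ<-cong : ∀ n {f g : ℕ → Carrier} → (∀ k → k < n → f k ≈ g k) → Σ< n f ≈ Σ< n g
  Σ<-cong zero    f≈g = refl
  Σ<-cong (suc n) f≈g =
    +-cong (Σ<-cong n (λ k k<n → f≈g k (ℕₚ.m<n⇒m<1+n k<n))) (f≈g n ℕₚ.≤-refl)

  Σ<-distrib-+ : ∀ n (f g : ℕ → Carrier) → Σ< n (λ k → f k + g k) ≈ Σ< n f + Σ< n g
  Σ<-distrib-+ zero    f g = sym (+-identityˡ 0#)
  Σ<-distrib-+ (suc n) f g =
    trans (+-congʳ (Σ<-distrib-+ n f g)) (+-interchange _ _ _ _)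

  *-distribˡ-Σ< : ∀ n a (f : ℕ → Carrier) → a * Σ< n f ≈ Σ< n (λ k → a * f k)
  *-distribˡ-Σ< zero    a f = zeroʳ a
  *-distribˡ-Σ< (suc n) a f = trans (distribˡ a _ _) (+-congʳ (*-distribˡ-Σ< n a f))

  Σ<-head : ∀ n (f : ℕ → Carrier) → Σ< (suc n) f ≈ f 0 + Σ< n (λ k → f (suc k))
  Σ<-head zero    f = +-comm 0# (f 0)
  Σ<-head (suc n) f = trans (+-congʳ (Σ<-head n f)) (+-assoc _ _ _)

  Σ<-truncate : ∀ {m n} {f : ℕ → Carrier} → m ≤ n → (∀ k → m ≤ k → f k ≈ 0#) →
                Σ< n f ≈ Σ< m f
  Σ<-truncate m≤n vanish with ℕₚ.m≤n⇒m<n∨m≡n m≤n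
  ... | inj₂ ≡.refl       = refl
  ... | inj₁ (s≤s m≤n-1) =
    trans (+-cong (Σ<-truncate m≤n-1 vanish) (vanish _ m≤n-1)) (+-identityʳ _)

  x*[y*x⁻¹]≈y : ∀ {x} → ¬ x ≈ 0# → ∀ y → x * (y * x ⁻¹) ≈ y
  x*[y*x⁻¹]≈y {x} x≉0 y = begin
    x * (y * x ⁻¹) ≈⟨ x*yz≈y*xz x y (x ⁻¹) ⟩
    y * (x * x ⁻¹) ≈⟨ *-congˡ (⁻¹-inverse x x≉0) ⟩
    y * 1#         ≈⟨ *-identityʳ y ⟩
    y              ∎

  x*y≈0⇒y≈0 : ∀ {x y} → ¬ x ≈ 0# → x * y ≈ 0# → y ≈ 0#
  x*y≈0⇒y≈0 {x} {y} x≉0 xy≈0 = begin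
    y              ≈⟨ x*[y*x⁻¹]≈y x≉0 y ⟨
    x * (y * x ⁻¹) ≈⟨ *-assoc x y (x ⁻¹) ⟨
    (x * y) * x ⁻¹ ≈⟨ *-congʳ xy≈0 ⟩
    0# * x ⁻¹      ≈⟨ zeroˡ _ ⟩
    0#             ∎

  x*y≉0⇒x≉0 : ∀ {x y} → ¬ x * y ≈ 0# → ¬ x ≈ 0#
  x*y≉0⇒x≉0 {x} {y} xy≉0 x≈0 = xy≉0 (trans (*-congʳ x≈0) (zeroˡ y))

  x*y≉0⇒y≉0 : ∀ {x y} → ¬ x * y ≈ 0# → ¬ y ≈ 0#
  x*y≉0⇒y≉0 {x} {y} xy≉0 y≈0 = xy≉0 (trans (*-congˡ y≈0) (zeroʳ x))

  x≉0⇒x^n≉0 : ∀ {x} → ¬ x ≈ 0# → ∀ n → ¬ x ^ n ≈ 0#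
  x≉0⇒x^n≉0 x≉0 zero    1≈0 = 0≉1 (sym 1≈0)
  x≉0⇒x^n≉0 x≉0 (suc n) xⁿ⁺¹≈0 = x≉0⇒x^n≉0 x≉0 n (x*y≈0⇒y≈0 x≉0 xⁿ⁺¹≈0)

  fromℕ-+ : ∀ m n → fromℕ (m ℕ.+ n) ≈ fromℕ m + fromℕ n
  fromℕ-+ zero    n = sym (+-identityˡ _)
  fromℕ-+ (suc m) n = trans (+-congˡ (fromℕ-+ m n)) (sym (+-assoc _ _ _))

  fromℕ-1 : fromℕ 1 ≈ 1#
  fromℕ-1 = +-identityʳ 1#

  x+y*[[z-x]*y⁻¹]≈z : ∀ x {y} → ¬ y ≈ 0# → ∀ z → x + y * ((z - x) * y ⁻¹) ≈ z
  x+y*[[z-x]*y⁻¹]≈z x {y} y≉0 z = begin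
    x + y * ((z - x) * y ⁻¹) ≈⟨ +-congˡ (x*[y*x⁻¹]≈y y≉0 (z - x)) ⟩
    x + (z - x)              ≈⟨ +-comm x (z - x) ⟩
    (z - x) + x              ≈⟨ //-rightDividesˡ x z ⟩
    z                        ∎

  module Binomial (a b : Carrier) where
    L : Mat
    L = P 0# a b λ[ b ] μ

    L-suc-suc : ∀ i k → L (suc i) (suc k) ≈ a * L i k + b * L i (suc k)
    L-suc-suc i k = +-congʳ (trans (+-congʳ (zeroˡ _)) (+-identityˡ _))

    L-upper : ∀ i k → i < k → L i k ≈ 0#
    L-upper zero    (suc k) _         = refl
    L-upper (suc i) (suc k) (s≤s i<k) = begin
      L (suc i) (suc k)         ≈⟨ L-suc-suc i k ⟩
      a * L i k + b * L i (suc k)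
        ≈⟨ +-cong (*-congˡ (L-upper i k i<k)) (*-congˡ (L-upper i (suc k) (ℕₚ.m<n⇒m<1+n i<k))) ⟩
      a * 0# + b * 0#           ≈⟨ +-cong (zeroʳ a) (zeroʳ b) ⟩
      0# + 0#                   ≈⟨ +-identityʳ 0# ⟩
      0#                        ∎

    L-diagonal : ∀ i → L i i ≈ a ^ i
    L-diagonal zero    = refl
    L-diagonal (suc i) = begin
      L (suc i) (suc i)               ≈⟨ L-suc-suc i i ⟩
      a * L i i + b * L i (suc i)
        ≈⟨ +-cong (*-congˡ (L-diagonal i)) (*-congˡ (L-upper i (suc i) ℕₚ.≤-refl)) ⟩
      a * a ^ i + b * 0#              ≈⟨ +-congˡ (zeroʳ b) ⟩
      a * a ^ i + 0#                  ≈⟨ +-identityʳ _ ⟩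
      a ^ suc i                       ∎

    binomial : ℕ → ℕ → Carrier
    binomial i k = fromℕ (i C k) * (a ^ k * b ^ (i ∸ k))

    binomial-diagonal : ∀ i → binomial i i ≈ a ^ i
    binomial-diagonal i = begin
      fromℕ (i C i) * (a ^ i * b ^ (i ∸ i))
        ≈⟨ *-cong (reflexive (≡.cong fromℕ (nCn≡1 i)))
                  (*-congˡ (reflexive (≡.cong (b ^_) (ℕₚ.n∸n≡0 i)))) ⟩
      fromℕ 1 * (a ^ i * 1#)   ≈⟨ *-cong fromℕ-1 (*-identityʳ _) ⟩
      1# * a ^ i               ≈⟨ *-identityˡ _ ⟩
      a ^ i                    ∎

    binomial-pascal : ∀ i k → k < i → binomial (suc i) (suc k) ≈ a * binomial i k + b * binomial i (suc k)
    binomial-pascal (suc i) k (s≤s k≤i) = begin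
      fromℕ (suc (suc i) C suc k) * ((a * a ^ k) * b ^ (suc i ∸ k))
        ≈⟨ *-congʳ (reflexive (≡.cong fromℕ (≡.sym (nCk+nC[k+1]≡[n+1]C[k+1] (suc i) k)))) ⟩
      fromℕ (suc i C k ℕ.+ suc i C suc k) * ((a * a ^ k) * b ^ (suc i ∸ k))
        ≈⟨ *-cong (fromℕ-+ (suc i C k) (suc i C suc k)) (*-congˡ b^[1+i-k]) ⟩
      (p + q) * ((a * a ^ k) * (b * b ^ (i ∸ k)))
        ≈⟨ solve 6 (λ a b p q aᵏ bⁱ⁻ᵏ →
                       (p :+ q) :* ((a :* aᵏ) :* (b :* bⁱ⁻ᵏ))
                    := a :* (p :* (aᵏ :* (b :* bⁱ⁻ᵏ))) :+ b :* (q :* ((a :* aᵏ) :* bⁱ⁻ᵏ)))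
                 refl a b p q (a ^ k) (b ^ (i ∸ k)) ⟩
      a * (p * (a ^ k * (b * b ^ (i ∸ k)))) + b * (q * ((a * a ^ k) * b ^ (i ∸ k)))
        ≈⟨ +-congʳ (*-congˡ (*-congˡ (*-congˡ b^[1+i-k]))) ⟨
      a * binomial (suc i) k + b * binomial (suc i) (suc k) ∎
      where
      p = fromℕ (suc i C k)
      q = fromℕ (suc i C suc k)
      b^[1+i-k] : b ^ (suc i ∸ k) ≈ b * b ^ (i ∸ k)
      b^[1+i-k] = reflexive (≡.cong (b ^_) (ℕₚ.+-∸-assoc 1 k≤i))

    L-binomial : ∀ i k → k ≤ i → L i k ≈ binomial i k
    L-binomial i       zero    _ = sym (trans (*-cong fromℕ-1 (*-identityˡ _)) (*-identityˡ _))
    L-binomial (suc i) (suc k) (s≤s k≤i) with ℕₚ.m≤n⇒m<n∨m≡n k≤i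
    ... | inj₂ ≡.refl = trans (L-diagonal (suc k)) (sym (binomial-diagonal (suc k)))
    ... | inj₁ k<i    = begin
      L (suc i) (suc k)               ≈⟨ L-suc-suc i k ⟩
      a * L i k + b * L i (suc k)
        ≈⟨ +-cong (*-congˡ (L-binomial i k k≤i)) (*-congˡ (L-binomial i (suc k) k<i)) ⟩
      a * binomial i k + b * binomial i (suc k) ≈⟨ binomial-pascal i k k<i ⟨
      binomial (suc i) (suc k)        ∎

    apply : Seq → Seq
    apply f i = Σ< (suc i) (λ k → L i k * f k)

    apply-cong : ∀ {f g : Seq} → (∀ k → f k ≈ g k) → ∀ i → apply f i ≈ apply g i
    apply-cong f≈g i = Σ<-cong (suc i) (λ k _ → *-congˡ (f≈g k))

    apply-+ : ∀ (f g : Seq) i → apply (λ k → f k + g k) i ≈ apply f i + apply g i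
    apply-+ f g i = trans (Σ<-cong (suc i) (λ k _ → distribˡ (L i k) (f k) (g k))) (Σ<-distrib-+ (suc i) _ _)

    apply-* : ∀ d (f : Seq) i → apply (λ k → d * f k) i ≈ d * apply f i
    apply-* d f i = begin
      Σ< (suc i) (λ k → L i k * (d * f k)) ≈⟨ Σ<-cong (suc i) (λ k _ → x*yz≈y*xz (L i k) d (f k)) ⟩
      Σ< (suc i) (λ k → d * (L i k * f k)) ≈⟨ *-distribˡ-Σ< (suc i) d _ ⟨
      d * apply f i                        ∎

    apply-zero : ∀ f → apply f 0 ≈ f 0
    apply-zero f = trans (+-identityˡ _) (*-identityˡ _)

    apply-suc : ∀ f i → apply f (suc i) ≈ b * apply f i + a * apply (λ k → f (suc k)) i
    apply-suc f i = begin
      apply f (suc i)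
        ≈⟨ Σ<-head (suc i) _ ⟩
      b * L i 0 * f 0 + Σ< (suc i) (λ k → L (suc i) (suc k) * f (suc k))
        ≈⟨ +-congˡ (Σ<-cong (suc i) (λ k _ → trans (*-congʳ (L-suc-suc i k)) (distribʳ _ _ _))) ⟩
      b * L i 0 * f 0 + Σ< (suc i) (λ k → a * L i k * f (suc k) + b * L i (suc k) * f (suc k))
        ≈⟨ +-congˡ (trans (Σ<-distrib-+ (suc i) _ _) (+-cong (factor a) (factor b))) ⟩
      b * L i 0 * f 0 + (a * A + b * Σ< (suc i) (λ k → L i (suc k) * f (suc k)))
        ≈⟨ +-congˡ (+-congˡ (*-congˡ (Σ<-truncate (ℕₚ.n≤1+n i) strictly-upper))) ⟩
      b * L i 0 * f 0 + (a * A + b * Σ< i (λ k → L i (suc k) * f (suc k)))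
        ≈⟨ solve 6 (λ b l₀ f₀ a A B →
                       b :* l₀ :* f₀ :+ (a :* A :+ b :* B) := b :* (l₀ :* f₀ :+ B) :+ a :* A)
                 refl b (L i 0) (f 0) a A (Σ< i (λ k → L i (suc k) * f (suc k))) ⟩
      b * (L i 0 * f 0 + Σ< i (λ k → L i (suc k) * f (suc k))) + a * A
        ≈⟨ +-congʳ (*-congˡ (Σ<-head i _)) ⟨
      b * apply f i + a * A ∎
      where
      A = apply (λ k → f (suc k)) i
      factor : ∀ c {g : ℕ → Carrier} →
               Σ< (suc i) (λ k → c * g k * f (suc k)) ≈ c * Σ< (suc i) (λ k → g k * f (suc k))
      factor c = trans (Σ<-cong (suc i) (λ k _ → *-assoc _ _ _)) (sym (*-distribˡ-Σ< (suc i) c _))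
      strictly-upper : ∀ k → i ≤ k → L i (suc k) * f (suc k) ≈ 0#
      strictly-upper k i≤k = trans (*-congʳ (L-upper i (suc k) (s≤s i≤k))) (zeroˡ _)

    module _ (γ : Seq) where
      open Inv a b γ

      prefix-agrees : ∀ n k → k < n → prefix n k ≡ ρ k
      prefix-agrees (suc n) k k<1+n with k ≡ᵇ n in k≡ᵇn
      ... | true  =
        ≡.cong (λ m → step m (prefix m)) (≡.sym (ℕₚ.≡ᵇ⇒≡ k n (≡.subst T (≡.sym k≡ᵇn) _)))
      ... | false with ℕₚ.m≤n⇒m<n∨m≡n (ℕₚ.≤-pred k<1+n)
      ...   | inj₁ k<n = prefix-agrees n k k<n
      ...   | inj₂ k≡n = ⊥-elim (≡.subst T k≡ᵇn (ℕₚ.≡⇒≡ᵇ k n k≡n))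

      binomial-invSeq : ¬ a ≈ 0# → ∀ i → Σ< (suc i) (λ k → binomial i k * ρ k) ≈ γ i
      binomial-invSeq a≉0 zero    = trans (+-identityˡ _) (trans (*-congʳ (binomial-diagonal 0)) (*-identityˡ _))
      binomial-invSeq a≉0 (suc i) = begin
        S + binomial (suc i) (suc i) * ρ (suc i)
          ≈⟨ +-congˡ (*-cong (binomial-diagonal (suc i)) (*-congʳ (+-congˡ (-‿cong prefix-sum)))) ⟩
        S + a ^ suc i * ((γ (suc i) - S) * (a ^ suc i) ⁻¹)
          ≈⟨ x+y*[[z-x]*y⁻¹]≈z S (x≉0⇒x^n≉0 a≉0 (suc i)) (γ (suc i)) ⟩
        γ (suc i) ∎
        where
        S = Σ< (suc i) (λ k → binomial (suc i) k * ρ k)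
        prefix-sum : Σ< (suc i) (λ k → binomial (suc i) k * prefix (suc i) k) ≈ S
        prefix-sum = Σ<-cong (suc i) (λ k k<1+i → *-congˡ (reflexive (prefix-agrees (suc i) k k<1+i)))

    apply-invSeq : ¬ a ≈ 0# → ∀ γ i → apply (invSeq a b γ) i ≈ γ i
    apply-invSeq a≉0 γ i =
      trans (Σ<-cong (suc i) (λ k k<1+i → *-congʳ (L-binomial i k (ℕₚ.≤-pred k<1+i))))
            (binomial-invSeq γ a≉0 i)

  Recurrent : Carrier → Carrier → Carrier → Mat → Set ℓ
  Recurrent x y z M = ∀ i j → M (suc i) (suc j) ≈ x * M (suc i) j + y * M i j + z * M i (suc j)

  P-unique : ∀ {x y z α β} {M : Mat} → Recurrent x y z M →
             (∀ i → α i ≈ M i 0) → (∀ j → β (suc j) ≈ M 0 (suc j)) →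
             ∀ i j → P x y z α β i j ≈ M i j
  P-unique M-rec col row i       zero    = col i
  P-unique M-rec col row zero    (suc j) = row j
  P-unique M-rec col row (suc i) (suc j) =
    trans (+-cong (+-cong (*-congˡ (P-unique M-rec col row (suc i) j))
                          (*-congˡ (P-unique M-rec col row i j)))
                  (*-congˡ (P-unique M-rec col row i (suc j))))
          (sym (M-rec i j))

  module Sandwich (r s v w : Carrier) where
    module Lᵣ = Binomial r s
    module Lᵥ = Binomial v w

    -- (L_{r,s} Q L_{v,w}^t)_{ij}, each sum cut off at the support k ≤ i, l ≤ j of the factors
    sandwich : Mat → Mat
    sandwich Q i j = Lᵥ.apply (λ l → Lᵣ.apply (λ k → Q k l) i) j

    sandwich-cong : ∀ {Q Q′ : Mat} → (∀ k l → Q k l ≈ Q′ k l) →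
                    ∀ i j → sandwich Q i j ≈ sandwich Q′ i j
    sandwich-cong Q≈Q′ i = Lᵥ.apply-cong (λ l → Lᵣ.apply-cong (λ k → Q≈Q′ k l) i)

    sandwich-+ : ∀ (Q Q′ : Mat) i j →
                 sandwich (λ k l → Q k l + Q′ k l) i j ≈ sandwich Q i j + sandwich Q′ i j
    sandwich-+ Q Q′ i j = trans (Lᵥ.apply-cong (λ l → Lᵣ.apply-+ _ _ i) j) (Lᵥ.apply-+ _ _ j)

    sandwich-* : ∀ d (Q : Mat) i j → sandwich (λ k l → d * Q k l) i j ≈ d * sandwich Q i j
    sandwich-* d Q i j = trans (Lᵥ.apply-cong (λ l → Lᵣ.apply-* d _ i) j) (Lᵥ.apply-* d _ j)

    sandwich-suc-row : ∀ (Q : Mat) i j →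
                       sandwich Q (suc i) j ≈ s * sandwich Q i j + r * sandwich (λ k → Q (suc k)) i j
    sandwich-suc-row Q i j =
      trans (Lᵥ.apply-cong (λ l → Lᵣ.apply-suc _ i) j)
            (trans (Lᵥ.apply-+ _ _ j) (+-cong (Lᵥ.apply-* s _ j) (Lᵥ.apply-* r _ j)))

    sandwich-suc-col : ∀ (Q : Mat) i j →
                       sandwich Q i (suc j) ≈ w * sandwich Q i j + v * sandwich (λ k l → Q k (suc l)) i j
    sandwich-suc-col Q i = Lᵥ.apply-suc _

    sandwich-col-zero : ∀ (Q : Mat) i → sandwich Q i 0 ≈ Lᵣ.apply (λ k → Q k 0) i
    sandwich-col-zero Q i = Lᵥ.apply-zero (λ l → Lᵣ.apply (λ k → Q k l) i)

    sandwich-row-zero : ∀ (Q : Mat) j → sandwich Q 0 j ≈ Lᵥ.apply (Q 0) j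
    sandwich-row-zero Q = Lᵥ.apply-cong (λ l → Lᵣ.apply-zero (λ k → Q k l))

    -- The hypotheses are the defining equations of the weights of the theorem, with the
    -- divisions by v, r and r v cleared.
    sandwich-recurrent : ∀ {x y z x′ y′ z′} {Q : Mat} → Recurrent x′ y′ z′ Q →
                         w + v * x′ ≈ x → s + r * z′ ≈ z → s * w + r * v * y′ ≈ y + x * s + z * w →
                         Recurrent x y z (sandwich Q)
    sandwich-recurrent {x} {y} {z} {x′} {y′} {z′} {Q} Q-rec x≈ z≈ y≈ i j = begin
      sandwich Q (suc i) (suc j)
        ≈⟨ sandwich-suc-row Q i (suc j) ⟩
      s * sandwich Q i (suc j) + r * sandwich Q↓ i (suc j)
        ≈⟨ +-cong (*-congˡ (sandwich-suc-col Q i j)) (*-congˡ (sandwich-suc-col Q↓ i j)) ⟩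
      s * (w * A + v * B) + r * (w * C + v * sandwich Q↘ i j)
        ≈⟨ +-congˡ (*-congˡ (+-congˡ (*-congˡ Q↘-sandwich))) ⟩
      s * (w * A + v * B) + r * (w * C + v * (x′ * C + y′ * A + z′ * B))
        ≈⟨ solve 10 (λ r s v w x′ y′ z′ A B C →
                       s :* (w :* A :+ v :* B) :+ r :* (w :* C :+ v :* (x′ :* C :+ y′ :* A :+ z′ :* B))
                    := (s :* w :+ r :* v :* y′) :* A :+ v :* (s :+ r :* z′) :* B :+ r :* (w :+ v :* x′) :* C)
                 refl r s v w x′ y′ z′ A B C ⟩
      (s * w + r * v * y′) * A + v * (s + r * z′) * B + r * (w + v * x′) * C
        ≈⟨ +-cong (+-cong (*-congʳ y≈) (*-congʳ (*-congˡ z≈))) (*-congʳ (*-congˡ x≈)) ⟩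
      (y + x * s + z * w) * A + v * z * B + r * x * C
        ≈⟨ solve 10 (λ r s v w x y z A B C →
                       (y :+ x :* s :+ z :* w) :* A :+ v :* z :* B :+ r :* x :* C
                    := x :* (s :* A :+ r :* C) :+ y :* A :+ z :* (w :* A :+ v :* B))
                 refl r s v w x y z A B C ⟩
      x * (s * A + r * C) + y * A + z * (w * A + v * B)
        ≈⟨ +-cong (+-congʳ (*-congˡ (sandwich-suc-row Q i j))) (*-congˡ (sandwich-suc-col Q i j)) ⟨
      x * sandwich Q (suc i) j + y * A + z * sandwich Q i (suc j) ∎
      where
      Q↓ Q→ Q↘ : Mat
      Q↓ k l = Q (suc k) l
      Q→ k l = Q k (suc l)
      Q↘ k l = Q (suc k) (suc l)
      A = sandwich Q i j
      B = sandwich Q→ i j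
      C = sandwich Q↓ i j
      Q↘-sandwich : sandwich Q↘ i j ≈ x′ * C + y′ * A + z′ * B
      Q↘-sandwich = begin
        sandwich Q↘ i j
          ≈⟨ sandwich-cong Q-rec i j ⟩
        sandwich (λ k l → x′ * Q↓ k l + y′ * Q k l + z′ * Q→ k l) i j
          ≈⟨ trans (sandwich-+ _ _ i j) (+-congʳ (sandwich-+ _ _ i j)) ⟩
        sandwich (λ k l → x′ * Q↓ k l) i j + sandwich (λ k l → y′ * Q k l) i j
          + sandwich (λ k l → z′ * Q→ k l) i j
          ≈⟨ +-cong (+-cong (sandwich-* x′ Q↓ i j) (sandwich-* y′ Q i j)) (sandwich-* z′ Q→ i j) ⟩
        x′ * C + y′ * A + z′ * B ∎

    mul-sandwich : ∀ {n i j} (Q : Mat) → i < n → j < n →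
                   mul n (mul n Lᵣ.L Q) (transpose Lᵥ.L) i j ≈ sandwich Q i j
    mul-sandwich {n} {i} {j} Q i<n j<n = begin
      Σ< n (λ l → Σ< n (λ k → Lᵣ.L i k * Q k l) * Lᵥ.L j l)
        ≈⟨ Σ<-truncate j<n (λ l j<l → trans (*-congˡ (Lᵥ.L-upper j l j<l)) (zeroʳ _)) ⟩
      Σ< (suc j) (λ l → Σ< n (λ k → Lᵣ.L i k * Q k l) * Lᵥ.L j l)
        ≈⟨ Σ<-cong (suc j) (λ l _ → *-congʳ (Σ<-truncate i<n (λ k i<k →
             trans (*-congʳ (Lᵣ.L-upper i k i<k)) (zeroˡ _)))) ⟩
      Σ< (suc j) (λ l → Lᵣ.apply (λ k → Q k l) i * Lᵥ.L j l)
        ≈⟨ Σ<-cong (suc j) (λ l _ → *-comm _ _) ⟩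
      sandwich Q i j ∎

    P≈sandwich : ∀ {x y z x′ y′ z′ α β} → ¬ r * v ≈ 0# → α 0 ≈ β 0 →
                 w + v * x′ ≈ x → s + r * z′ ≈ z → s * w + r * v * y′ ≈ y + x * s + z * w →
                 ∀ i j → P x y z α β i j ≈ sandwich (P x′ y′ z′ (invSeq r s α) (invSeq v w β)) i j
    P≈sandwich {x} {y} {z} {x′} {y′} {z′} {α} {β} rv≉0 α₀≈β₀ x≈ z≈ y≈ =
      P-unique (sandwich-recurrent {Q = Q} (λ _ _ → refl) x≈ z≈ y≈) first-col first-row
      where
      ρ = invSeq r s α
      σ = invSeq v w β
      Q = P x′ y′ z′ ρ σ

      Q-first-row : ∀ l → Q 0 l ≈ σ l
      Q-first-row zero    = α₀≈β₀
      Q-first-row (suc l) = refl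

      first-col : ∀ k → α k ≈ sandwich Q k 0
      first-col k = sym (trans (sandwich-col-zero Q k) (Lᵣ.apply-invSeq (x*y≉0⇒x≉0 rv≉0) α k))

      first-row : ∀ l → β (suc l) ≈ sandwich Q 0 (suc l)
      first-row l = sym (begin
        sandwich Q 0 (suc l)    ≈⟨ sandwich-row-zero Q (suc l) ⟩
        Lᵥ.apply (Q 0) (suc l)  ≈⟨ Lᵥ.apply-cong Q-first-row (suc l) ⟩
        Lᵥ.apply σ (suc l)      ≈⟨ Lᵥ.apply-invSeq (x*y≉0⇒y≉0 rv≉0) β (suc l) ⟩
        β (suc l)               ∎)

theorem1 : {c ℓ : Level} (F : Field c ℓ) →
    let open FieldDefs F in
    (r s v w x y z : Carrier) → ¬ (r * v ≈ 0#) →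
    (α β : Seq) → α 0 ≈ β 0 →
    (n : ℕ) → 1 ≤ n → (i j : ℕ) → i < n → j < n →
    P x y z α β i j
      ≈ mul n
          (mul n (P 0# r s λ[ s ] μ)
                 (P ((x - w) * (v ⁻¹))
                    ((y + x * s + z * w - s * w) * ((r * v) ⁻¹))
                    ((z - s) * (r ⁻¹))
                    (invSeq r s α) (invSeq v w β)))
          (transpose (P 0# v w λ[ w ] μ)) i j
theorem1 F r s v w x y z rv≉0 α β α₀≈β₀ n _ i j i<n j<n =
  trans (P≈sandwich rv≉0 α₀≈β₀
           (x+y*[[z-x]*y⁻¹]≈z w (x*y≉0⇒y≉0 rv≉0) x)
           (x+y*[[z-x]*y⁻¹]≈z s (x*y≉0⇒x≉0 rv≉0) z)
           (x+y*[[z-x]*y⁻¹]≈z (s * w) rv≉0 (y + x * s + z * w))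
           i j)
        (sym (mul-sandwich _ i<n j<n))
  where
  open FieldDefs F
  open Factorisation F
  open Sandwich r s v w
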